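{- Let $n\ge 1$ and $1\le k\le n$. There is a bijection between the set of permutations $\pi\in S_n$ with $w(\pi)=0$ and exactly $k-1$ descents and the set of partitions of $\{1,\dots,n\}$ into $k$ (nonempty) blocks. In particular the number of such permutations is the Stirling number of the second kind $\left\{ n \atop k\right\}$.
   Context: For a word $\sigma$ of distinct positive integers, $\mathrm{des}(\sigma)$ is its number of descents (adjacent positions $i$ with $\sigma_i>\sigma_{i+1}$) and $\mathrm{st}(\sigma)$ is its standardization (replace the $j$-th smallest letter by $j$), a permutation. The weight $w\colon S_n\to\mathbb Z_{\ge0}$ is defined recursively: if $\pi$ is the identity $12\cdots n$ or the decreasing permutation $n(n-1)\cdots1$, then $w(\pi)=0$. Otherwise form the word $\pi(1)\cdots\pi(n)(n+1)$ and write it as $\pi_L\cdot 1\cdot\pi_R$, where $\pi_L$ is the (possibly empty) subword left of the letter $1$ and $\pi_R$ the subword right of $1$ (ending in $n+1$). Decompose $\pi_L=\pi_1\cdots\pi_l$: $\pi_1$ is the prefix of $\pi_L$ ending at its largest letter, $\pi_2$ the prefix of the remaining word ending at its largest letter, and so on. Then $w(\pi)=w(\mathrm{st}(\pi_R))+\mathrm{des}(\pi_R)+\sum_{i=1}^{l}\bigl(w(\mathrm{st}(\pi_i))+\mathrm{des}(\pi_i)\bigr)$. -}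

module Defs where

open import Data.Nat using (ℕ; zero; suc; _+_; _*_; _<ᵇ_; _≡ᵇ_; _⊔_)
import Data.Nat as ℕ
open import Data.Bool using (Bool; true; false; if_then_else_; _∨_; not)
open import Data.List using (List; []; _∷_; _++_; length; map; upTo; reverse; filter; foldr; deduplicate; spanᵇ; [_])
open import Data.List.Relation.Binary.Permutation.Propositional using (_↭_)
open import Data.Product using (_×_; _,_; proj₁; proj₂)
open import Data.Fin using (Fin)
open import Data.Nat.ListAction using (sum)
open import Data.Fin.Subset using (Subset; _∈_)
open import Data.Vec using (Vec; lookup; toList)
import Data.Vec.Properties as VecP
open import Data.Bool.Properties using () renaming (_≟_ to _≟B_)
open import Relation.Binary.PropositionalEquality using (_≡_)

oneTo : ℕ → List ℕ
oneTo n = map suc (upTo n)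

des : List ℕ → ℕ
des []           = 0
des (x ∷ [])     = 0
des (x ∷ y ∷ ys) = (if y <ᵇ x then 1 else 0) + des (y ∷ ys)

st : List ℕ → List ℕ
st σ = map (λ x → suc (length (filter (λ y → y ℕ.<? x) σ))) σ

-- largest letter of a word (0 for the empty word)
maxL : List ℕ → ℕ
maxL = foldr _⊔_ 0

splitAfter : ℕ → List ℕ → List ℕ × List ℕ
splitAfter m [] = [] , []
splitAfter m (x ∷ xs) with x ≡ᵇ m
... | true  = x ∷ [] , xs
... | false = let r = splitAfter m xs in x ∷ proj₁ r , proj₂ r

-- decomposition π_L = π_1 ⋯ π_l : π_1 is the prefix ending at the largest
-- letter, π_2 the prefix of the rest ending at its largest letter, etc.
-- (fuel = length of the word, which suffices since each block is nonempty)
blocksF : ℕ → List ℕ → List (List ℕ)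
blocksF zero     _  = []
blocksF (suc f) [] = []
blocksF (suc f) l@(_ ∷ _) =
  let r = splitAfter (maxL l) l in proj₁ r ∷ blocksF f (proj₂ r)

maxPrefixBlocks : List ℕ → List (List ℕ)
maxPrefixBlocks l = blocksF (length l) l

_==_ : List ℕ → List ℕ → Bool
[] == [] = true
(x ∷ xs) == (y ∷ ys) = (x ≡ᵇ y) Data.Bool.∧ (xs == ys)
_ == _ = false

-- Each recursive call is on st(π_R) or st(π_i); it either shortens the
-- permutation or (when π(1)=1) lengthens its final increasing run of
-- fixed points n-j+1,…,n, so the recursion depth is < n*n + 1 and the
-- fuel below is never exhausted.
wF : ℕ → List ℕ → ℕ
wF zero    π = 0
wF (suc f) π =
  let n = length π in
  if (π == oneTo n) ∨ (π == reverse (oneTo n)) then 0 else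
  (let word = π ++ [ suc n ]
       sp   = spanᵇ (λ x → not (x ≡ᵇ 1)) word
       πL   = proj₁ sp
       πR   = Data.List.drop 1 (proj₂ sp)
   in wF f (st πR) + des πR
      + sum (map (λ b → wF f (st b) + des b) (maxPrefixBlocks πL)))

-- w : S_n → ℕ, for π given in one-line notation π(1)⋯π(n)
w : List ℕ → ℕ
w π = wF (suc (length π * length π)) π

-- Permutations π ∈ S_n with w(π) = 0 and exactly k-1 descents.
-- (proof fields are irrelevant, so equality is equality of words)

record ZeroWeightPerm (n k : ℕ) : Set where
  constructor mkZWP
  field
    word       : List ℕ
    .isPerm    : word ↭ oneTo n
    .weight0   : w word ≡ 0
    .desCount  : des word + 1 ≡ k

-- A partition is given by the map i ↦ (block containing i), as a vector
-- of subsets; the blocks of the partition are the entries of this vector.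

numBlocks : ∀ {n} → Vec (Subset n) n → ℕ
numBlocks B = length (deduplicate (VecP.≡-dec _≟B_) (toList B))

record SetPartition (n k : ℕ) : Set where
  constructor mkSP
  field
    blockOf     : Vec (Subset n) n
    .selfMem    : ∀ i → i ∈ lookup blockOf i
    .consistent : ∀ i j → j ∈ lookup blockOf i → lookup blockOf j ≡ lookup blockOf i
    .nBlocks    : numBlocks blockOf ≡ k

-- A permutation has weight zero exactly when it is the identity, the decreasing permutation, or
-- π_L 1 π_R with π_R increasing and every block of the decomposition of π_L by successive maxima
-- increasing.  In each case π is a concatenation of increasing runs, each ending with the largest
-- letter still to come and the run of 1 coming last; these are precisely the ascending runs of π,
-- with a descent between any two consecutive ones.  Conversely a set partition of {1, …, n} is
-- the set of ascending runs of exactly one such permutation: write each block increasingly, the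
-- blocks without 1 by decreasing maximum and then the block of 1.  So k blocks correspond to
-- k − 1 descents.

module Submission where

open import Defs
open import Data.Nat using (ℕ; zero; suc; _+_; _*_; _≤_; _<_; _≮_; _>_; _≡ᵇ_; _<ᵇ_; z≤n; s≤s)
open import Data.Nat.Properties
open import Data.Nat.ListAction using (sum)
open import Data.Bool using (Bool; true; false; T; if_then_else_; not; _∨_)
open import Data.Bool.Properties using (T-≡) renaming (_≟_ to _≟ᴮ_)
open import Data.Empty using (⊥-elim)
open import Data.Fin using (Fin; toℕ; fromℕ<)
open import Data.Fin.Properties using (toℕ<n; toℕ-fromℕ<; fromℕ<-toℕ)
open import Data.Fin.Subset using (Subset) renaming (_∈_ to _∈ₛ_; ⊥ to ∅)
open import Data.List as List
  using (List; []; _∷_; _++_; [_]; _∷ʳ_; concat; map; length; filter; reverse; upTo; downFrom; head; spanᵇ; drop; deduplicate)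
import Data.List.Properties as Listₚ
open import Data.List.Membership.Propositional using (_∈_; _∉_; find; lose)
open import Data.List.Membership.Propositional.Properties
open import Data.List.Membership.Propositional.Properties.WithK using (unique∧set⇒bag)
open import Data.List.Membership.DecPropositional _≟_ using (_∈?_)
open import Data.List.Relation.Binary.BagAndSetEquality using (∼bag⇒↭)
open import Data.List.Relation.Binary.Permutation.Propositional using (_↭_; ↭-sym; ↭⇒↭ₛ)
open import Data.List.Relation.Binary.Permutation.Propositional.Properties using (∈-resp-↭; ↭-length)
import Data.List.Relation.Binary.Permutation.Setoid.Properties as Permₛ
open import Data.List.Relation.Binary.Subset.Propositional using (_⊆_)
open import Data.List.Relation.Unary.All as All using (All; []; _∷_)
import Data.List.Relation.Unary.All.Properties as Allₚ
open import Data.List.Relation.Unary.AllPairs as AllPairs using ([]; _∷_)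
open import Data.List.Relation.Unary.Any using (Any; here; there; any?)
import Data.List.Relation.Unary.Any.Properties as Anyₚ
open import Data.List.Relation.Unary.Linked as Linked using (Linked; []; [-]; _∷_)
import Data.List.Relation.Unary.Linked.Properties as Linkedₚ
open Linkedₚ using (Linked⇒AllPairs)
open import Data.List.Relation.Unary.Unique.Propositional using (Unique)
import Data.List.Relation.Unary.Unique.Propositional.Properties as Uniqueₚ
open import Data.List.Relation.Unary.Unique.DecPropositional.Properties using (deduplicate-!)
open import Data.Maybe using (just)
open import Data.Maybe.Relation.Binary.Connected using (Connected; just; just-nothing)
open import Data.Product using (∃; ∃₂; _×_; _,_; proj₁; proj₂)
open import Data.Sum using (_⊎_; inj₁; inj₂)
open import Data.Vec as Vec using (Vec; lookup; toList)
import Data.Vec.Properties as Vecₚ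
open import Function.Base using (_∘_; flip; case_of_)
open import Function.Bundles using (_⤖_; Equivalence; mk⇔; mk↔ₛ′)
open import Function.Properties.Inverse using (↔⇒⤖)
open import Level using (0ℓ)
open import Relation.Binary using (Rel; Transitive; Irreflexive)
open import Relation.Binary.PropositionalEquality hiding ([_])
open import Relation.Nullary using (¬_; yes; no; ¬?)
open import Relation.Nullary.Decidable using (Dec; isYes; T?; _×-dec_; dec-true; dec-false; toWitness; fromWitness; recompute)
open import Relation.Unary using (Decidable; _≐_)


module _ {A : Set} {_≺_ : Rel A 0ℓ} (≺-trans : Transitive _≺_) (≺-irrefl : Irreflexive _≡_ _≺_) where

  Linked-head-All : ∀ {x xs} → Linked _≺_ (x ∷ xs) → All (x ≺_) xs
  Linked-head-All = AllPairs.head ∘ Linked⇒AllPairs ≺-trans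

  Linked-∷⁺ : ∀ {x ys} → All (x ≺_) ys → Linked _≺_ ys → Linked _≺_ (x ∷ ys)
  Linked-∷⁺ []      _ = [-]
  Linked-∷⁺ (x≺ ∷ _) s = x≺ ∷ s

  strictlySorted⇒Unique : ∀ {xs} → Linked _≺_ xs → Unique xs
  strictlySorted⇒Unique = AllPairs.map (λ x≺y x≡y → ≺-irrefl x≡y x≺y) ∘ Linked⇒AllPairs ≺-trans

  strictlySorted-≡ : ∀ {xs ys} → Linked _≺_ xs → Linked _≺_ ys → xs ⊆ ys → ys ⊆ xs → xs ≡ ys
  strictlySorted-≡ {[]} {[]} _ _ _ _ = refl
  strictlySorted-≡ {[]} {y ∷ ys} _ _ _ ys⊆ with ys⊆ (here refl)
  ... | ()
  strictlySorted-≡ {x ∷ xs} {[]} _ _ xs⊆ _ with xs⊆ (here refl)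
  ... | ()
  strictlySorted-≡ {x ∷ xs} {y ∷ ys} sx sy xs⊆ ys⊆ =
    cong₂ _∷_ x≡y (strictlySorted-≡ (Linked.tail sx) (Linked.tail sy) tail⊆ tail⊇)
    where
    x≡y : x ≡ y
    x≡y with xs⊆ (here refl) | ys⊆ (here refl)
    ... | here x≡y | _         = x≡y
    ... | there _  | here y≡x  = sym y≡x
    ... | there y≺ | there x≺  =
      ⊥-elim (≺-irrefl refl (≺-trans (All.lookup (Linked-head-All sy) y≺) (All.lookup (Linked-head-All sx) x≺)))
    tail⊆ : xs ⊆ ys
    tail⊆ {z} z∈xs with xs⊆ (there z∈xs)
    ... | here refl = ⊥-elim (≺-irrefl x≡y (All.lookup (Linked-head-All sx) z∈xs))
    ... | there z∈ys = z∈ys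
    tail⊇ : ys ⊆ xs
    tail⊇ {z} z∈ys with ys⊆ (there z∈ys)
    ... | here refl = ⊥-elim (≺-irrefl (sym x≡y) (All.lookup (Linked-head-All sy) z∈ys))
    ... | there z∈xs = z∈xs

Linked-∷ʳ⁺ : ∀ {A : Set} {R : Rel A 0ℓ} {xs s} → Linked R xs → All (λ x → R x s) xs → Linked R (xs ∷ʳ s)
Linked-∷ʳ⁺ []        []            = [-]
Linked-∷ʳ⁺ [-]       (x<s ∷ [])    = x<s ∷ [-]
Linked-∷ʳ⁺ (x<y ∷ l) (_ ∷ y<s ∷ a) = x<y ∷ Linked-∷ʳ⁺ l (y<s ∷ a)

Linked-++⁻ˡ : ∀ {A : Set} {R : Rel A 0ℓ} xs {ys} → Linked R (xs ++ ys) → Linked R xs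
Linked-++⁻ˡ []           _         = []
Linked-++⁻ˡ (x ∷ [])     _         = [-]
Linked-++⁻ˡ (x ∷ y ∷ xs) (r ∷ l)   = r ∷ Linked-++⁻ˡ (y ∷ xs) l

module _ {A : Set} where

  Unique-++⁻ˡ : ∀ xs {ys : List A} → Unique (xs ++ ys) → Unique xs
  Unique-++⁻ˡ []       _          = []
  Unique-++⁻ˡ (x ∷ xs) (x∉ ∷ xs!) = Allₚ.++⁻ˡ xs x∉ ∷ Unique-++⁻ˡ xs xs!

  Unique-++⁻ʳ : ∀ xs {ys : List A} → Unique (xs ++ ys) → Unique ys
  Unique-++⁻ʳ []       ys!       = ys!
  Unique-++⁻ʳ (x ∷ xs) (_ ∷ xs!) = Unique-++⁻ʳ xs xs!

  Unique-++-disjoint : ∀ xs {ys : List A} {u v} → Unique (xs ++ ys) → u ∈ xs → v ∈ ys → u ≢ v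
  Unique-++-disjoint (x ∷ xs) (x∉ ∷ _) (here refl) v∈ys = All.lookup (Allₚ.++⁻ʳ xs x∉) v∈ys
  Unique-++-disjoint (x ∷ xs) (_ ∷ xs!) (there u∈xs) v∈ys = Unique-++-disjoint xs xs! u∈xs v∈ys

Unique-concat-map : ∀ {A B : Set} (f : A → List B) {xs} → Unique xs → (∀ {x} → x ∈ xs → Unique (f x)) →
                    (∀ {x y v} → x ∈ xs → y ∈ xs → v ∈ f x → v ∈ f y → x ≡ y) → Unique (concat (map f xs))
Unique-concat-map f {[]}     _          _  _    = []
Unique-concat-map f {x ∷ xs} (x∉ ∷ xs!) f! same =
  Uniqueₚ.++⁺ (f! (here refl)) (Unique-concat-map f xs! (f! ∘ there) λ p q → same (there p) (there q)) disjoint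
  where
  disjoint : ∀ {v} → ¬ (v ∈ f x × v ∈ concat (map f xs))
  disjoint (v∈fx , v∈rest) with ∈-concat⁻′ (map f xs) v∈rest
  ... | _ , v∈b , b∈ with ∈-map⁻ f b∈
  ... | y , y∈xs , refl = All.lookup x∉ y∈xs (same (here refl) (there y∈xs) v∈fx v∈b)

Unique-map⁺ : ∀ {A B : Set} (f : A → B) {xs} → Unique xs →
              (∀ {x y} → x ∈ xs → y ∈ xs → f x ≡ f y → x ≡ y) → Unique (map f xs)
Unique-map⁺ f {[]}     _          _   = []
Unique-map⁺ f {x ∷ xs} (x∉ ∷ xs!) inj =
  Allₚ.map⁺ (All.tabulate λ y∈ fx≡fy → All.lookup x∉ y∈ (inj (here refl) (there y∈) fx≡fy))
  ∷ Unique-map⁺ f xs! (λ p q → inj (there p) (there q))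

Unique-concat-∈ : ∀ {A : Set} {xss : List (List A)} {xs ys v} → Unique (concat xss) →
                  xs ∈ xss → ys ∈ xss → v ∈ xs → v ∈ ys → xs ≡ ys
Unique-concat-∈ {xss = zs ∷ xss} xss! (here refl) (here refl) _ _ = refl
Unique-concat-∈ {xss = zs ∷ xss} xss! (here refl) (there ys∈) v∈xs v∈ys =
  ⊥-elim (Unique-++-disjoint zs xss! v∈xs (∈-concat⁺′ v∈ys ys∈) refl)
Unique-concat-∈ {xss = zs ∷ xss} xss! (there xs∈) (here refl) v∈xs v∈ys =
  ⊥-elim (Unique-++-disjoint zs xss! v∈ys (∈-concat⁺′ v∈xs xs∈) refl)
Unique-concat-∈ {xss = zs ∷ xss} xss! (there xs∈) (there ys∈) v∈xs v∈ys =
  Unique-concat-∈ (Unique-++⁻ʳ zs xss!) xs∈ ys∈ v∈xs v∈ys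

concat-∷ʳ : ∀ {A : Set} (xss : List (List A)) xs → concat (xss ∷ʳ xs) ≡ concat xss ++ xs
concat-∷ʳ xss xs = trans (sym (Listₚ.concat-++ xss [ xs ])) (cong (concat xss ++_) (Listₚ.++-identityʳ xs))

sum-map-≡0 : ∀ {A : Set} (g : A → ℕ) {xs} → All (λ x → g x ≡ 0) xs → sum (map g xs) ≡ 0
sum-map-≡0 g []           = refl
sum-map-≡0 g (gx≡0 ∷ gxs) rewrite gx≡0 = sum-map-≡0 g gxs

sum-map-≡0⁻ : ∀ {A : Set} (g : A → ℕ) xs → sum (map g xs) ≡ 0 → All (λ x → g x ≡ 0) xs
sum-map-≡0⁻ g []       _ = []
sum-map-≡0⁻ g (x ∷ xs) s = m+n≡0⇒m≡0 (g x) s ∷ sum-map-≡0⁻ g xs (m+n≡0⇒n≡0 (g x) s)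

T-extensional : ∀ {a b} → (T a → T b) → (T b → T a) → a ≡ b
T-extensional {false} {false} _ _ = refl
T-extensional {false} {true}  _ b⇒a = ⊥-elim (b⇒a _)
T-extensional {true}  {false} a⇒b _ = ⊥-elim (a⇒b _)
T-extensional {true}  {true}  _ _ = refl

T⇒≡true : ∀ {b} → T b → b ≡ true
T⇒≡true = Equivalence.to T-≡

≡true⇒T : ∀ {b} → b ≡ true → T b
≡true⇒T = Equivalence.from T-≡

T-≐ : ∀ {f g : ℕ → Bool} → (∀ x → f x ≡ g x) → (λ x → T (f x)) ≐ (λ x → T (g x))
T-≐ f≗g = (λ {x} → subst T (f≗g x)) , (λ {x} → subst T (sym (f≗g x)))

Vec-≡ : ∀ {A : Set} {n} {u v : Vec A n} → (∀ i → lookup u i ≡ lookup v i) → u ≡ v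
Vec-≡ {u = u} {v} eq = trans (sym (Vecₚ.tabulate∘lookup u)) (trans (Vecₚ.tabulate-cong eq) (Vecₚ.tabulate∘lookup v))

toList≡tabulate : ∀ {A : Set} {n} (v : Vec A n) → toList v ≡ List.tabulate (lookup v)
toList≡tabulate Vec.[]      = refl
toList≡tabulate (x Vec.∷ v) = cong (x ∷_) (toList≡tabulate v)


>-trans : Transitive _>_
>-trans = flip <-trans

>-irrefl : Irreflexive _≡_ _>_
>-irrefl = <-irrefl ∘ sym

InRange : ℕ → ℕ → Set
InRange n x = 1 ≤ x × x ≤ n

∈-oneTo⁻ : ∀ {n x} → x ∈ oneTo n → InRange n x
∈-oneTo⁻ x∈ with ∈-map⁻ suc x∈
... | _ , i∈ , refl = s≤s z≤n , ∈-upTo⁻ i∈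

∈-oneTo⁺ : ∀ {n x} → InRange n x → x ∈ oneTo n
∈-oneTo⁺ {x = suc i} (_ , i<n) = ∈-map⁺ suc (∈-upTo⁺ i<n)

oneTo-increasing : ∀ n → Linked _<_ (oneTo n)
oneTo-increasing n = Linkedₚ.map⁺ (Linkedₚ.applyUpTo⁺₂ (λ i → i) n (λ i → n<1+n (suc i)))

length-oneTo : ∀ n → length (oneTo n) ≡ n
length-oneTo n = trans (Listₚ.length-map suc (upTo n)) (Listₚ.length-upTo n)

oneTo-suc : ∀ n → oneTo (suc n) ≡ 1 ∷ map suc (oneTo n)
oneTo-suc n = cong (λ xs → 1 ∷ map suc xs) (sym (Listₚ.map-upTo suc n))

reverse-oneTo : ∀ n → reverse (oneTo n) ≡ map suc (downFrom n)
reverse-oneTo n = trans (sym (Listₚ.reverse-map suc (upTo n))) (cong (map suc) (Listₚ.reverse-upTo n))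

reverse-oneTo-decreasing : ∀ n → Linked _>_ (reverse (oneTo n))
reverse-oneTo-decreasing n = subst (Linked _>_) (sym (reverse-oneTo n))
  (Linkedₚ.map⁺ (Linkedₚ.applyDownFrom⁺₂ (λ i → i) n (λ i → n<1+n (suc i))))

record IsPermutation (n : ℕ) (π : List ℕ) : Set where
  field
    unique   : Unique π
    inRange  : ∀ {x} → x ∈ π → InRange n x
    complete : ∀ {x} → InRange n x → x ∈ π
open IsPermutation public

↭⇒IsPermutation : ∀ {n π} → π ↭ oneTo n → IsPermutation n π
↭⇒IsPermutation {n} π↭ = record
  { unique   = Permₛ.Unique-resp-↭ (setoid ℕ) (↭⇒↭ₛ (↭-sym π↭))
                 (strictlySorted⇒Unique <-trans <-irrefl (oneTo-increasing n))
  ; inRange  = ∈-oneTo⁻ ∘ ∈-resp-↭ π↭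
  ; complete = ∈-resp-↭ (↭-sym π↭) ∘ ∈-oneTo⁺
  }

IsPermutation⇒↭ : ∀ {n π} → IsPermutation n π → π ↭ oneTo n
IsPermutation⇒↭ {n} P = ∼bag⇒↭ (unique∧set⇒bag (unique P)
  (strictlySorted⇒Unique <-trans <-irrefl (oneTo-increasing n))
  (mk⇔ (∈-oneTo⁺ ∘ inRange P) (complete P ∘ ∈-oneTo⁻)))

IsPermutation-length : ∀ {n π} → IsPermutation n π → length π ≡ n
IsPermutation-length {n} P = trans (↭-length (IsPermutation⇒↭ P)) (length-oneTo n)


lastOf : ℕ → List ℕ → ℕ
lastOf x []       = x
lastOf _ (y ∷ ys) = lastOf y ys

lastOf-∈ : ∀ x xs → lastOf x xs ∈ x ∷ xs
lastOf-∈ x []       = here refl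
lastOf-∈ x (y ∷ ys) = there (lastOf-∈ y ys)

lastOf-maximum : ∀ {x xs y} → Linked _<_ (x ∷ xs) → y ∈ x ∷ xs → y ≤ lastOf x xs
lastOf-maximum {xs = []}     _        (here refl) = ≤-refl
lastOf-maximum {xs = _ ∷ _} (x<z ∷ s) (here refl) = <⇒≤ (<-≤-trans x<z (lastOf-maximum s (here refl)))
lastOf-maximum {xs = _ ∷ _} (_ ∷ s)   (there y∈) = lastOf-maximum s y∈

lastOf-∷ʳ : ∀ u m → ∃₂ λ x xs → u ∷ʳ m ≡ x ∷ xs × lastOf x xs ≡ m
lastOf-∷ʳ []      m = m , [] , refl , refl
lastOf-∷ʳ (a ∷ u) m with lastOf-∷ʳ u m
... | x , xs , eq , last≡m = a , x ∷ xs , cong (a ∷_) eq , last≡m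

∷ʳ-lastOf : ∀ x xs → ∃ λ u → x ∷ xs ≡ u ∷ʳ lastOf x xs
∷ʳ-lastOf x []       = [] , refl
∷ʳ-lastOf x (y ∷ ys) with ∷ʳ-lastOf y ys
... | u , eq = x ∷ u , cong (x ∷_) eq

increasing-head : ∀ {b xs} → Linked _<_ xs → b ∈ xs → (∀ {y} → y ∈ xs → b ≤ y) → ∃ λ t → xs ≡ b ∷ t
increasing-head {xs = y ∷ t} _ (here refl) _  = t , refl
increasing-head {xs = y ∷ t} s (there b∈t) b≤ =
  ⊥-elim (<⇒≱ (All.lookup (Linked-head-All <-trans <-irrefl s) b∈t) (b≤ (here refl)))

des-increasing : ∀ {xs} → Linked _<_ xs → des xs ≡ 0
des-increasing []                      = refl
des-increasing [-]                     = refl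
des-increasing {x ∷ y ∷ _} (x<y ∷ s) rewrite dec-false (y <? x) (<⇒≯ x<y) = des-increasing s

des-∷≡0 : ∀ x y ys → des (x ∷ y ∷ ys) ≡ 0 → y ≮ x × des (y ∷ ys) ≡ 0
des-∷≡0 x y ys d with y <ᵇ x in y<ᵇx
... | false = (λ y<x → case trans (sym (dec-true (y <? x) y<x)) y<ᵇx of λ ()) , d

des≡0⇒nondecreasing : ∀ {xs} → des xs ≡ 0 → Linked _≤_ xs
des≡0⇒nondecreasing {[]}         _ = []
des≡0⇒nondecreasing {x ∷ []}     _ = [-]
des≡0⇒nondecreasing {x ∷ y ∷ ys} d =
  ≮⇒≥ (proj₁ (des-∷≡0 x y ys d)) ∷ des≡0⇒nondecreasing (proj₂ (des-∷≡0 x y ys d))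

nondecreasing∧Unique⇒increasing : ∀ {xs} → Linked _≤_ xs → Unique xs → Linked _<_ xs
nondecreasing∧Unique⇒increasing []        _                = []
nondecreasing∧Unique⇒increasing [-]       _                = [-]
nondecreasing∧Unique⇒increasing (x≤y ∷ s) ((x≢y ∷ _) ∷ u) =
  ≤∧≢⇒< x≤y x≢y ∷ nondecreasing∧Unique⇒increasing s u

rank : List ℕ → ℕ → ℕ
rank σ x = suc (length (filter (_<? x) σ))

st-increasing : ∀ {xs} → Linked _<_ xs → st xs ≡ oneTo (length xs)
st-increasing {[]}     _ = refl
st-increasing {x ∷ xs} s = begin
  rank (x ∷ xs) x ∷ map (rank (x ∷ xs)) xs ≡⟨ cong₂ _∷_ rank-head (Listₚ.map-cong-local rank-tail) ⟩
  1 ∷ map (suc ∘ rank xs) xs               ≡⟨ cong (1 ∷_) (Listₚ.map-∘ xs) ⟩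
  1 ∷ map suc (st xs)                      ≡⟨ cong (λ ys → 1 ∷ map suc ys) (st-increasing (Linked.tail s)) ⟩
  1 ∷ map suc (oneTo (length xs))          ≡⟨ oneTo-suc (length xs) ⟨
  oneTo (length (x ∷ xs))                  ∎
  where
  open ≡-Reasoning
  x< : All (x <_) xs
  x< = Linked-head-All <-trans <-irrefl s
  rank-head : rank (x ∷ xs) x ≡ 1
  rank-head = cong (suc ∘ length) (trans (Listₚ.filter-reject (_<? x) (<-irrefl refl))
                                         (Listₚ.filter-none (_<? x) (All.map <⇒≯ x<)))
  rank-tail : All (λ y → rank (x ∷ xs) y ≡ suc (rank xs y)) xs
  rank-tail = All.map (λ x<y → cong (suc ∘ length) (Listₚ.filter-accept (_<? _) x<y)) x<


-- Ascending runs

prependToRuns : ℕ → List (List ℕ) → List (List ℕ)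
prependToRuns x ((y ∷ r) ∷ rs) = if x <ᵇ y then (x ∷ y ∷ r) ∷ rs else [ x ] ∷ (y ∷ r) ∷ rs
prependToRuns x rs             = [ x ] ∷ rs

runsOf : List ℕ → List (List ℕ)
runsOf []       = []
runsOf (x ∷ xs) = prependToRuns x (runsOf xs)

data AscendingRuns : List (List ℕ) → Set where
  []  : AscendingRuns []
  run : ∀ {x xs rs} → Linked _<_ (x ∷ xs) → Connected _>_ (just (lastOf x xs)) (head (concat rs)) →
        AscendingRuns rs → AscendingRuns ((x ∷ xs) ∷ rs)

AscendingRuns-increasing : ∀ {rs r} → AscendingRuns rs → r ∈ rs → Linked _<_ r
AscendingRuns-increasing (run s _ _) (here refl) = s
AscendingRuns-increasing (run _ _ R) (there r∈)  = AscendingRuns-increasing R r∈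

prependToRuns-head : ∀ y rs → ∃₂ λ r rs′ → prependToRuns y rs ≡ (y ∷ r) ∷ rs′
prependToRuns-head y []             = _ , _ , refl
prependToRuns-head y ([] ∷ rs)      = _ , _ , refl
prependToRuns-head y ((z ∷ r) ∷ rs) with y <ᵇ z
... | true  = _ , _ , refl
... | false = _ , _ , refl

runsOf-run-++ : ∀ {x xs} X → Linked _<_ (x ∷ xs) → Connected _>_ (just (lastOf x xs)) (head X) →
                runsOf ((x ∷ xs) ++ X) ≡ (x ∷ xs) ∷ runsOf X
runsOf-run-++ {xs = []} []      _ _ = refl
runsOf-run-++ {x} {[]} (y ∷ Y) _ (just y<x) with prependToRuns-head y (runsOf Y)
... | _ , _ , eq rewrite eq | dec-false (x <? y) (<⇒≯ y<x) = refl
runsOf-run-++ {x} {x′ ∷ xs} X (x<x′ ∷ s) c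
  rewrite runsOf-run-++ X s c | dec-true (x <? x′) x<x′ = refl

runsOf-concat : ∀ {rs} → AscendingRuns rs → runsOf (concat rs) ≡ rs
runsOf-concat []              = refl
runsOf-concat (run {rs = rs} s c R) = trans (runsOf-run-++ (concat rs) s c) (cong (_ ∷_) (runsOf-concat R))

des-run-++ : ∀ {x xs y} Y → Linked _<_ (x ∷ xs) → y < lastOf x xs →
             des ((x ∷ xs) ++ y ∷ Y) ≡ suc (des (y ∷ Y))
des-run-++ {x} {[]} {y} _ _ y<x rewrite dec-true (y <? x) y<x = refl
des-run-++ {x} {x′ ∷ xs} Y (x<x′ ∷ s) y< rewrite dec-false (x′ <? x) (<⇒≯ x<x′) = des-run-++ Y s y<

des-concat : ∀ {r rs} → AscendingRuns (r ∷ rs) → des (concat (r ∷ rs)) + 1 ≡ length (r ∷ rs)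
des-concat (run {x} {xs} {[]} s _ [])
  rewrite Listₚ.++-identityʳ (x ∷ xs) | des-increasing s = refl
des-concat (run {rs = ([] ∷ _)} _ _ ())
des-concat (run {rs = ((y ∷ ys) ∷ rs)} s (just y<) R)
  rewrite des-run-++ (ys ++ concat rs) s y< = cong suc (des-concat R)

SameRun : List ℕ → ℕ → ℕ → Set
SameRun π x y = Any (λ r → x ∈ r × y ∈ r) (runsOf π)

sameRun? : ∀ π x y → Dec (SameRun π x y)
sameRun? π x y = any? (λ r → (x ∈? r) ×-dec (y ∈? r)) (runsOf π)

sameRun : List ℕ → ℕ → ℕ → Bool
sameRun π x y = isYes (sameRun? π x y)


-- Decomposition by maxima

maxL-upper : ∀ {y X} → y ∈ X → y ≤ maxL X
maxL-upper {X = x ∷ X} (here refl) = m≤m⊔n x (maxL X)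
maxL-upper {X = x ∷ X} (there y∈)  = ≤-trans (maxL-upper y∈) (m≤n⊔m x (maxL X))

maxL-least : ∀ {m X} → (∀ {y} → y ∈ X → y ≤ m) → maxL X ≤ m
maxL-least {X = []}    _  = z≤n
maxL-least {X = x ∷ X} ≤m = ⊔-lub (≤m (here refl)) (maxL-least (≤m ∘ there))

maxL-∈-∷ : ∀ x X → maxL (x ∷ X) ∈ x ∷ X
maxL-∈-∷ x []      = here (⊔-identityʳ x)
maxL-∈-∷ x (y ∷ X) with ⊔-sel x (maxL (y ∷ X))
... | inj₁ ≡x = here ≡x
... | inj₂ ≡m = there (subst (_∈ y ∷ X) (sym ≡m) (maxL-∈-∷ y X))

maxL-∈ : ∀ {y X} → y ∈ X → maxL X ∈ X
maxL-∈ {X = x ∷ X} _ = maxL-∈-∷ x X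

maxL-≡ : ∀ {m X} → m ∈ X → (∀ {y} → y ∈ X → y ≤ m) → maxL X ≡ m
maxL-≡ m∈ ≤m = ≤-antisym (maxL-least ≤m) (maxL-upper m∈)

maxL-increasing : ∀ {x xs} → Linked _<_ (x ∷ xs) → maxL (x ∷ xs) ≡ lastOf x xs
maxL-increasing {x} {xs} s = maxL-≡ (lastOf-∈ x xs) (lastOf-maximum s)

data MaxPrefixRuns : List (List ℕ) → Set where
  []  : MaxPrefixRuns []
  run : ∀ {x xs bs} → Linked _<_ (x ∷ xs) → All (_< lastOf x xs) (concat bs) →
        MaxPrefixRuns bs → MaxPrefixRuns ((x ∷ xs) ∷ bs)

run-maxL : ∀ {b bs y} → Linked _<_ b → y ∈ b → All (_< maxL b) (concat bs) → MaxPrefixRuns bs →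
           MaxPrefixRuns (b ∷ bs)
run-maxL {_ ∷ _} s _ <max B = run s (subst (λ m → All (_< m) _) (maxL-increasing s) <max) B

MaxPrefixRuns-nonempty : ∀ {bs b} → MaxPrefixRuns bs → b ∈ bs → ∃₂ λ x xs → b ≡ x ∷ xs
MaxPrefixRuns-nonempty (run _ _ _) (here refl) = _ , _ , refl
MaxPrefixRuns-nonempty (run _ _ B) (there b∈)  = MaxPrefixRuns-nonempty B b∈

MaxPrefixRuns-maxima : ∀ {bs} → MaxPrefixRuns bs → Linked _>_ (map maxL bs)
MaxPrefixRuns-maxima []                    = []
MaxPrefixRuns-maxima (run _ _ [])          = [-]
MaxPrefixRuns-maxima (run {x} {xs} s <last B@(run {y} {ys} _ _ _)) =
  subst (_> maxL (y ∷ ys)) (sym (maxL-increasing s)) (All.lookup <last (∈-++⁺ˡ (maxL-∈-∷ y ys)))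
  ∷ MaxPrefixRuns-maxima B

splitAfter-∷ʳ : ∀ {m} u X → m ∉ u → splitAfter m (u ++ m ∷ X) ≡ (u ∷ʳ m , X)
splitAfter-∷ʳ {m} []      X _  rewrite dec-true (m ≟ m) refl = refl
splitAfter-∷ʳ {m} (a ∷ u) X m∉
  rewrite dec-false (a ≟ m) (m∉ ∘ here ∘ sym) | splitAfter-∷ʳ u X (m∉ ∘ there) = refl

blocksF-[] : ∀ f → blocksF f [] ≡ []
blocksF-[] zero    = refl
blocksF-[] (suc f) = refl

blocksF-MaxPrefixRuns : ∀ f {bs} → MaxPrefixRuns bs → length (concat bs) ≤ f → blocksF f (concat bs) ≡ bs
blocksF-MaxPrefixRuns f       []                          _ = blocksF-[] f
blocksF-MaxPrefixRuns (suc f) (run {x} {xs} {bs} s <last B) (s≤s len≤) =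
  cong₂ (λ p rest → proj₁ p ∷ rest) split
        (trans (cong (blocksF f ∘ proj₂) split) (blocksF-MaxPrefixRuns f B (≤-trans len-rest len≤)))
  where
  R : List ℕ
  R = concat bs
  m : ℕ
  m = lastOf x xs
  u : List ℕ
  u = proj₁ (∷ʳ-lastOf x xs)
  x∷xs≡ : x ∷ xs ≡ u ∷ʳ m
  x∷xs≡ = proj₂ (∷ʳ-lastOf x xs)
  max≡last : maxL ((x ∷ xs) ++ R) ≡ m
  max≡last = maxL-≡ (∈-++⁺ˡ (lastOf-∈ x xs)) λ y∈ → case ∈-++⁻ (x ∷ xs) y∈ of λ where
    (inj₁ y∈run)  → lastOf-maximum s y∈run
    (inj₂ y∈rest) → <⇒≤ (All.lookup <last y∈rest)
  m∉u : m ∉ u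
  m∉u m∈u = Unique-++-disjoint u (subst Unique x∷xs≡ (strictlySorted⇒Unique <-trans <-irrefl s)) m∈u (here refl) refl
  split : splitAfter (maxL ((x ∷ xs) ++ R)) ((x ∷ xs) ++ R) ≡ (x ∷ xs , R)
  split = begin
    splitAfter (maxL ((x ∷ xs) ++ R)) ((x ∷ xs) ++ R) ≡⟨ cong₂ splitAfter max≡last (cong (_++ R) x∷xs≡) ⟩
    splitAfter m ((u ∷ʳ m) ++ R)                      ≡⟨ cong (splitAfter m) (Listₚ.++-assoc u [ m ] R) ⟩
    splitAfter m (u ++ m ∷ R)                         ≡⟨ splitAfter-∷ʳ u R m∉u ⟩
    (u ∷ʳ m , R)                                      ≡⟨ cong (_, R) x∷xs≡ ⟨
    (x ∷ xs , R)                                      ∎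
    where open ≡-Reasoning
  len-rest : length R ≤ length (xs ++ R)
  len-rest = subst (length R ≤_) (sym (Listₚ.length-++ xs)) (m≤n+m (length R) (length xs))

blocksF-step : ∀ f {x X} → Unique (x ∷ X) → ∃₂ λ u X′ →
               x ∷ X ≡ u ++ maxL (x ∷ X) ∷ X′ × blocksF (suc f) (x ∷ X) ≡ (u ∷ʳ maxL (x ∷ X)) ∷ blocksF f X′
blocksF-step f {x} {X} x∷X! with ∈-∃++ (maxL-∈-∷ x X)
... | u , X′ , x∷X≡ = u , X′ , x∷X≡ , cong (λ p → proj₁ p ∷ blocksF f (proj₂ p)) split
  where
  m∉u : maxL (x ∷ X) ∉ u
  m∉u m∈u = Unique-++-disjoint u (subst Unique x∷X≡ x∷X!) m∈u (here refl) refl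
  split : splitAfter (maxL (x ∷ X)) (x ∷ X) ≡ (u ∷ʳ maxL (x ∷ X) , X′)
  split = trans (cong (splitAfter _) x∷X≡) (splitAfter-∷ʳ u X′ m∉u)

blocksF-decomposition : ∀ f L → length L ≤ f → Unique L → All (λ b → des b ≡ 0) (blocksF f L) →
                        concat (blocksF f L) ≡ L × MaxPrefixRuns (blocksF f L)
blocksF-decomposition f [] _ _ _ rewrite blocksF-[] f = refl , []
blocksF-decomposition (suc f) (x ∷ X) (s≤s len≤) x∷X! des≡0 with blocksF-step f x∷X!
... | u , X′ , x∷X≡ , blocks≡ =
  subst (λ bs → concat bs ≡ x ∷ X × MaxPrefixRuns bs) (sym blocks≡) (split-runs (subst (All _) blocks≡ des≡0))
  where
  m : ℕ
  m = maxL (x ∷ X)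
  L! : Unique ((u ∷ʳ m) ++ X′)
  L! = subst Unique (trans x∷X≡ (sym (Listₚ.++-assoc u [ m ] X′))) x∷X!
  X′-len : length X′ ≤ f
  X′-len = ≤-trans (≤-pred (subst (suc (length X′) ≤_) length≡ (m≤n+m _ (length u)))) len≤
    where
    length≡ : length u + suc (length X′) ≡ suc (length X)
    length≡ = trans (sym (Listₚ.length-++ u)) (cong length (sym x∷X≡))
  below-m : All (_< m) X′
  below-m = All.tabulate λ {z} z∈ →
    ≤∧≢⇒< (maxL-upper (subst (z ∈_) (sym x∷X≡) (∈-++⁺ʳ u (there z∈))))
          (λ z≡m → Unique-++-disjoint (u ∷ʳ m) L! (∈-++⁺ʳ u (here refl)) z∈ (sym z≡m))
  split-runs : All (λ b → des b ≡ 0) ((u ∷ʳ m) ∷ blocksF f X′) →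
               concat ((u ∷ʳ m) ∷ blocksF f X′) ≡ x ∷ X × MaxPrefixRuns ((u ∷ʳ m) ∷ blocksF f X′)
  split-runs (d ∷ ds) with blocksF-decomposition f X′ X′-len (Unique-++⁻ʳ (u ∷ʳ m) L!) ds | lastOf-∷ʳ u m
  ... | concat≡X′ , rest | y , ys , block≡ , last≡m =
    trans (cong ((u ∷ʳ m) ++_) concat≡X′) (trans (Listₚ.++-assoc u [ m ] X′) (sym x∷X≡)) ,
    subst (λ b → MaxPrefixRuns (b ∷ blocksF f X′)) (sym block≡)
      (run (subst (Linked _<_) block≡
             (nondecreasing∧Unique⇒increasing (des≡0⇒nondecreasing d) (Unique-++⁻ˡ (u ∷ʳ m) L!)))
           (subst₂ (λ l Z → All (_< l) Z) (sym last≡m) (sym concat≡X′) below-m)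
           rest)

MaxPrefixRuns⇒AscendingRuns : ∀ {bs t} → MaxPrefixRuns bs → All (1 <_) (concat bs) → Linked _<_ (1 ∷ t) →
                              AscendingRuns (bs ∷ʳ (1 ∷ t))
MaxPrefixRuns⇒AscendingRuns []                           _    s = run s just-nothing []
MaxPrefixRuns⇒AscendingRuns {t = t} (run {x} {xs} {bs} s <last B) 1<bs s₁ =
  run s (subst (λ X → Connected _>_ (just (lastOf x xs)) (head X)) (sym (concat-∷ʳ bs (1 ∷ t))) (descent <last))
      (MaxPrefixRuns⇒AscendingRuns B (Allₚ.++⁻ʳ (x ∷ xs) 1<bs) s₁)
  where
  1<last : 1 < lastOf x xs
  1<last = All.lookup 1<bs (∈-++⁺ˡ (lastOf-∈ x xs))
  descent : ∀ {X} → All (_< lastOf x xs) X → Connected _>_ (just (lastOf x xs)) (head (X ++ 1 ∷ t))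
  descent []        = just 1<last
  descent (y< ∷ _)  = just y<


-- Permutations of weight zero

==-refl : ∀ xs → (xs == xs) ≡ true
==-refl []       = refl
==-refl (x ∷ xs) rewrite dec-true (x ≟ x) refl = ==-refl xs

==⇒≡ : ∀ xs ys → (xs == ys) ≡ true → xs ≡ ys
==⇒≡ []       []       _  = refl
==⇒≡ (x ∷ xs) (y ∷ ys) eq with x ≡ᵇ y in x≡ᵇy
... | true = cong₂ _∷_ (≡ᵇ⇒≡ x y (≡true⇒T x≡ᵇy)) (==⇒≡ xs ys eq)

wF-oneTo : ∀ f n → wF f (oneTo n) ≡ 0
wF-oneTo zero    n = refl
wF-oneTo (suc f) n rewrite length-oneTo n | ==-refl (oneTo n) = refl

blockWeight : ℕ → List ℕ → ℕ
blockWeight f b = wF f (st b) + des b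

-- The value of wF (suc f) π when π is neither the identity nor the decreasing permutation.
recursiveWeight : ℕ → List ℕ → ℕ
recursiveWeight f π =
  let sp = spanᵇ (λ x → not (x ≡ᵇ 1)) (π ++ [ suc (length π) ])
  in blockWeight f (drop 1 (proj₂ sp)) + sum (map (blockWeight f) (maxPrefixBlocks (proj₁ sp)))

wF-suc≡0 : ∀ f π → wF (suc f) π ≡ 0 →
           π ≡ oneTo (length π) ⊎ π ≡ reverse (oneTo (length π)) ⊎ recursiveWeight f π ≡ 0
wF-suc≡0 f π w≡0 with π == oneTo (length π) in isId | π == reverse (oneTo (length π)) in isDec
... | true  | _     = inj₁ (==⇒≡ _ _ isId)
... | false | true  = inj₂ (inj₁ (==⇒≡ _ _ isDec))
... | false | false = inj₂ (inj₂ w≡0)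

wF-suc≤recursiveWeight : ∀ f π → wF (suc f) π ≤ recursiveWeight f π
wF-suc≤recursiveWeight f π with (π == oneTo (length π)) ∨ (π == reverse (oneTo (length π)))
... | true  = z≤n
... | false = ≤-refl

spanᵇ-≢1 : ∀ L R → 1 ∉ L → spanᵇ (λ x → not (x ≡ᵇ 1)) (L ++ 1 ∷ R) ≡ (L , 1 ∷ R)
spanᵇ-≢1 []      R _   = refl
spanᵇ-≢1 (a ∷ L) R 1∉ rewrite dec-false (a ≟ 1) (1∉ ∘ here ∘ sym) | spanᵇ-≢1 L R (1∉ ∘ there) = refl

recursiveWeight-split : ∀ f L R → 1 ∉ L → recursiveWeight f (L ++ 1 ∷ R) ≡
  blockWeight f (R ∷ʳ suc (length (L ++ 1 ∷ R))) + sum (map (blockWeight f) (maxPrefixBlocks L))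
recursiveWeight-split f L R 1∉L
  rewrite Listₚ.++-assoc L (1 ∷ R) [ suc (length (L ++ 1 ∷ R)) ]
        | spanᵇ-≢1 L (R ∷ʳ suc (length (L ++ 1 ∷ R))) 1∉L = refl

blockWeight-increasing : ∀ f {b} → Linked _<_ b → blockWeight f b ≡ 0
blockWeight-increasing f {b} s rewrite st-increasing s | wF-oneTo f (length b) = des-increasing s

record ZeroWeightForm (π : List ℕ) : Set where
  constructor form
  field
    blocks     : List (List ℕ)
    tail       : List ℕ
    π≡         : π ≡ concat blocks ++ 1 ∷ tail
    blocks-max : MaxPrefixRuns blocks
    tail-inc   : Linked _<_ (1 ∷ tail)

ZeroWeightForm⇒w≡0 : ∀ {n π} → IsPermutation n π → ZeroWeightForm π → w π ≡ 0
ZeroWeightForm⇒w≡0 {n} {π} P (form bs t refl B s) =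
  n≤0⇒n≡0 (≤-trans (wF-suc≤recursiveWeight (length π * length π) π) (≤-reflexive recursive≡0))
  where
  L : List ℕ
  L = concat bs
  f : ℕ
  f = length π * length π
  1∉L : 1 ∉ L
  1∉L 1∈L = Unique-++-disjoint L (unique P) 1∈L (here refl) refl
  t<top : All (_< suc (length π)) t
  t<top = All.tabulate λ x∈t → s≤s (subst (_ ≤_) (sym (IsPermutation-length P))
                                   (proj₂ (inRange P (∈-++⁺ʳ L (there x∈t)))))
  recursive≡0 : recursiveWeight f π ≡ 0
  recursive≡0 rewrite recursiveWeight-split f L t 1∉L
                    | blockWeight-increasing f (Linked-∷ʳ⁺ (Linked.tail s) t<top)
                    | blocksF-MaxPrefixRuns (length L) B ≤-refl = sum-map-≡0 (blockWeight f) (blocks≡0 B)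
    where
    blocks≡0 : ∀ {bs} → MaxPrefixRuns bs → All (λ b → blockWeight f b ≡ 0) bs
    blocks≡0 []            = []
    blocks≡0 (run s′ _ B′) = blockWeight-increasing f s′ ∷ blocks≡0 B′

identity-form : ∀ m → ZeroWeightForm (oneTo (suc m))
identity-form m = form [] (map suc (oneTo m)) (oneTo-suc m)
  [] (subst (Linked _<_) (oneTo-suc m) (oneTo-increasing (suc m)))

singletons-MaxPrefixRuns : ∀ {ds} → Linked _>_ ds → MaxPrefixRuns (map [_] ds)
singletons-MaxPrefixRuns {[]}     _ = []
singletons-MaxPrefixRuns {d ∷ ds} s = run [-]
  (subst (All (_< d)) (sym (Listₚ.concat-map-[ ds ])) (Linked-head-All >-trans >-irrefl s))
  (singletons-MaxPrefixRuns (Linked.tail s))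

reverse-oneTo-suc : ∀ m → reverse (oneTo (suc m)) ≡ concat (map [_] (map suc (map suc (downFrom m)))) ++ [ 1 ]
reverse-oneTo-suc m = trans (reverse-oneTo (suc m))
  (trans (lemma m) (cong (_∷ʳ 1) (sym (Listₚ.concat-map-[ _ ]))))
  where
  lemma : ∀ m → map suc (downFrom (suc m)) ≡ map suc (map suc (downFrom m)) ∷ʳ 1
  lemma zero    = refl
  lemma (suc m) = cong (suc (suc m) ∷_) (lemma m)

decreasing-form : ∀ m → ZeroWeightForm (reverse (oneTo (suc m)))
decreasing-form m = form _ [] (reverse-oneTo-suc m)
  (singletons-MaxPrefixRuns
    (Linkedₚ.map⁺ (Linkedₚ.map⁺ (Linkedₚ.applyDownFrom⁺₂ (λ i → i) m (λ i → n<1+n (suc (suc i)))))))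
  [-]

recursiveWeight≡0⇒form : ∀ {n π} f → IsPermutation n π → 1 ≤ n → recursiveWeight f π ≡ 0 → ZeroWeightForm π
recursiveWeight≡0⇒form {n} {π} f P 1≤n rw≡0 with ∈-∃++ (complete P (≤-refl , 1≤n))
... | L , R , refl = form bs R (cong (_++ 1 ∷ R) (sym (proj₁ decomposition))) (proj₂ decomposition) tail-inc
  where
  1∉L : 1 ∉ L
  1∉L 1∈L = Unique-++-disjoint L (unique P) 1∈L (here refl) refl
  top : ℕ
  top = suc (length (L ++ 1 ∷ R))
  bs : List (List ℕ)
  bs = maxPrefixBlocks L
  split≡0 : blockWeight f (R ∷ʳ top) + sum (map (blockWeight f) bs) ≡ 0
  split≡0 = trans (sym (recursiveWeight-split f L R 1∉L)) rw≡0
  des-bs : All (λ b → des b ≡ 0) bs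
  des-bs = All.map (λ {b} → m+n≡0⇒n≡0 (wF f (st b)))
                   (sum-map-≡0⁻ (blockWeight f) bs (m+n≡0⇒n≡0 (blockWeight f (R ∷ʳ top)) split≡0))
  decomposition : concat bs ≡ L × MaxPrefixRuns bs
  decomposition = blocksF-decomposition (length L) L ≤-refl (Unique-++⁻ˡ L (unique P)) des-bs
  des-R : des (R ∷ʳ top) ≡ 0
  des-R = m+n≡0⇒n≡0 (wF f (st (R ∷ʳ top))) (m+n≡0⇒m≡0 (blockWeight f (R ∷ʳ top)) split≡0)
  R! : Unique R
  R! = Unique-++⁻ʳ (L ∷ʳ 1) (subst Unique (sym (Listₚ.++-assoc L [ 1 ] R)) (unique P))
  R-inc : Linked _<_ R
  R-inc = nondecreasing∧Unique⇒increasing (Linked-++⁻ˡ R (des≡0⇒nondecreasing des-R)) R!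
  1<R : All (1 <_) R
  1<R = All.tabulate λ r∈ → ≤∧≢⇒< (proj₁ (inRange P (∈-++⁺ʳ L (there r∈))))
                                   (All.lookup (AllPairs.head (Unique-++⁻ʳ L (unique P))) r∈)
  tail-inc : Linked _<_ (1 ∷ R)
  tail-inc = Linked-∷⁺ <-trans <-irrefl 1<R R-inc

w≡0⇒ZeroWeightForm : ∀ {n π} → IsPermutation n π → 1 ≤ n → w π ≡ 0 → ZeroWeightForm π
w≡0⇒ZeroWeightForm {suc m} {π} P 1≤n w≡0 with wF-suc≡0 (length π * length π) π w≡0
... | inj₁ π≡id              = subst ZeroWeightForm (sym (trans π≡id (cong oneTo (IsPermutation-length P)))) (identity-form m)
... | inj₂ (inj₁ π≡dec)      =
  subst ZeroWeightForm (sym (trans π≡dec (cong (reverse ∘ oneTo) (IsPermutation-length P)))) (decreasing-form m)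
... | inj₂ (inj₂ recursive≡0) = recursiveWeight≡0⇒form (length π * length π) P 1≤n recursive≡0

ZeroWeightForm-runs : ∀ {n π} → IsPermutation n π → (F : ZeroWeightForm π) →
                      let open ZeroWeightForm F in
                      AscendingRuns (blocks ∷ʳ (1 ∷ tail)) × concat (blocks ∷ʳ (1 ∷ tail)) ≡ π
ZeroWeightForm-runs P (form bs t refl B s) =
  MaxPrefixRuns⇒AscendingRuns B 1<bs s , concat-∷ʳ bs (1 ∷ t)
  where
  1<bs : All (1 <_) (concat bs)
  1<bs = All.tabulate λ x∈ → ≤∧≢⇒< (proj₁ (inRange P (∈-++⁺ˡ x∈)))
                                    (λ 1≡x → Unique-++-disjoint (concat bs) (unique P) x∈ (here refl) (sym 1≡x))

runsOf-ZeroWeightForm : ∀ {n π} → IsPermutation n π → (F : ZeroWeightForm π) →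
                        let open ZeroWeightForm F in runsOf π ≡ blocks ∷ʳ (1 ∷ tail)
runsOf-ZeroWeightForm P F with ZeroWeightForm-runs P F
... | R , concat≡π = trans (cong runsOf (sym concat≡π)) (runsOf-concat R)

des-ZeroWeightForm : ∀ {n π} → IsPermutation n π → (F : ZeroWeightForm π) →
                     des π + 1 ≡ suc (length (ZeroWeightForm.blocks F))
des-ZeroWeightForm P F with ZeroWeightForm-runs P F
... | R , concat≡π = trans (cong (λ π → des π + 1) (sym concat≡π))
                           (trans (des-concat-∷ʳ R) (trans (Listₚ.length-++ (ZeroWeightForm.blocks F)) (+-comm _ 1)))
  where
  des-concat-∷ʳ : ∀ {rs r} → AscendingRuns (rs ∷ʳ r) → des (concat (rs ∷ʳ r)) + 1 ≡ length (rs ∷ʳ r)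
  des-concat-∷ʳ {[]}     = des-concat
  des-concat-∷ʳ {_ ∷ _} = des-concat


-- Letter equivalences and their canonical words

record IsLetterEquivalence (n : ℕ) (_~_ : ℕ → ℕ → Bool) : Set where
  field
    support   : ∀ {x y} → T (x ~ y) → InRange n x × InRange n y
    reflexive : ∀ {x} → InRange n x → T (x ~ x)
    transport : ∀ {x y} → T (x ~ y) → ∀ z → y ~ z ≡ x ~ z

  symmetric : ∀ {x y} → T (x ~ y) → T (y ~ x)
  symmetric {x} x~y = subst T (sym (transport x~y x)) (reflexive (proj₁ (support x~y)))

  transitive : ∀ {x y z} → T (x ~ y) → T (y ~ z) → T (x ~ z)
  transitive {z = z} x~y = subst T (transport x~y z)

IsLetterEquivalence-resp : ∀ {n} {_~_ _≈_ : ℕ → ℕ → Bool} → (∀ x y → x ~ y ≡ x ≈ y) →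
                           IsLetterEquivalence n _~_ → IsLetterEquivalence n _≈_
IsLetterEquivalence-resp {_~_ = _~_} {_≈_} ~≗≈ E = record
  { support   = λ {x} {y} → support ∘ subst T (sym (~≗≈ x y))
  ; reflexive = λ {x} → subst T (~≗≈ x x) ∘ reflexive
  ; transport = λ {x} {y} x≈y z →
      trans (sym (~≗≈ y z)) (trans (transport (subst T (sym (~≗≈ x y)) x≈y) z) (~≗≈ x z))
  }
  where open IsLetterEquivalence E

module Canonical (n : ℕ) (_~_ : ℕ → ℕ → Bool) where

  class : ℕ → List ℕ
  class x = filter (λ y → T? (x ~ y)) (oneTo n)

  top : ℕ → ℕ
  top x = maxL (class x)

  IsTop : ℕ → Set
  IsTop m = top m ≡ m × ¬ T (m ~ 1)

  isTop? : Decidable IsTop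
  isTop? m = (top m ≟ m) ×-dec ¬? (T? (m ~ 1))

  tops : List ℕ
  tops = filter isTop? (reverse (oneTo n))

  representatives : List ℕ
  representatives = tops ∷ʳ 1

  word : List ℕ
  word = concat (map class representatives)

word-cong : ∀ n {_~_ _≈_ : ℕ → ℕ → Bool} → (∀ x y → x ~ y ≡ x ≈ y) →
            Canonical.word n _~_ ≡ Canonical.word n _≈_
word-cong n {_~_} {_≈_} ~≗≈ =
  cong concat (trans (Listₚ.map-cong class≗ (C~.tops ∷ʳ 1)) (cong (map C≈.class ∘ (_∷ʳ 1)) tops≡))
  where
  module C~ = Canonical n _~_
  module C≈ = Canonical n _≈_
  class≗ : ∀ x → C~.class x ≡ C≈.class x
  class≗ x = Listₚ.filter-≐ (λ y → T? (x ~ y)) (λ y → T? (x ≈ y)) (T-≐ (~≗≈ x)) (oneTo n)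
  tops≡ : C~.tops ≡ C≈.tops
  tops≡ = Listₚ.filter-≐ C~.isTop? C≈.isTop?
    ((λ (t≡ , ≁1) → trans (cong maxL (sym (class≗ _))) t≡ , ≁1 ∘ subst T (sym (~≗≈ _ 1))) ,
     (λ (t≡ , ≁1) → trans (cong maxL (class≗ _)) t≡ , ≁1 ∘ subst T (~≗≈ _ 1)))
    (reverse (oneTo n))

module CanonicalProperties {n _~_} (E : IsLetterEquivalence n _~_) (1≤n : 1 ≤ n) where
  open IsLetterEquivalence E
  open Canonical n _~_

  ∈-class⁻ : ∀ {x y} → y ∈ class x → T (x ~ y)
  ∈-class⁻ {x} = proj₂ ∘ ∈-filter⁻ (λ y → T? (x ~ y)) {xs = oneTo n}

  ∈-class⁺ : ∀ {x y} → T (x ~ y) → y ∈ class x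
  ∈-class⁺ x~y = ∈-filter⁺ (λ y → T? (_ ~ y)) (∈-oneTo⁺ (proj₂ (support x~y))) x~y

  ∈-class-self : ∀ {x} → InRange n x → x ∈ class x
  ∈-class-self = ∈-class⁺ ∘ reflexive

  class-increasing : ∀ x → Linked _<_ (class x)
  class-increasing x = Linkedₚ.filter⁺ (λ y → T? (x ~ y)) <-trans (oneTo-increasing n)

  class-≡ : ∀ {x y} → T (x ~ y) → class y ≡ class x
  class-≡ x~y = Listₚ.filter-≐ (λ z → T? (_ ~ z)) (λ z → T? (_ ~ z)) (T-≐ (transport x~y)) (oneTo n)

  top-∈ : ∀ {x} → InRange n x → top x ∈ class x
  top-∈ = maxL-∈ ∘ ∈-class-self

  ≤-top : ∀ {x y} → T (x ~ y) → y ≤ top x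
  ≤-top = maxL-upper ∘ ∈-class⁺

  top-top : ∀ {x} → InRange n x → top (top x) ≡ top x
  top-top = cong maxL ∘ class-≡ ∘ ∈-class⁻ ∘ top-∈

  1-inRange : InRange n 1
  1-inRange = ≤-refl , 1≤n

  ∈-tops⁻ : ∀ {m} → m ∈ tops → InRange n m × IsTop m
  ∈-tops⁻ m∈ with ∈-filter⁻ isTop? m∈
  ... | m∈rev , isTop = ∈-oneTo⁻ (Anyₚ.reverse⁻ m∈rev) , isTop

  ∈-tops⁺ : ∀ {m} → InRange n m → IsTop m → m ∈ tops
  ∈-tops⁺ inR isTop = ∈-filter⁺ isTop? (Anyₚ.reverse⁺ (∈-oneTo⁺ inR)) isTop

  tops-decreasing : Linked _>_ tops
  tops-decreasing = Linkedₚ.filter⁺ isTop? >-trans (reverse-oneTo-decreasing n)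

  1∉tops : 1 ∉ tops
  1∉tops 1∈ = proj₂ (proj₂ (∈-tops⁻ 1∈)) (reflexive 1-inRange)

  representatives-unique : Unique representatives
  representatives-unique = Uniqueₚ.++⁺ (strictlySorted⇒Unique >-trans >-irrefl tops-decreasing) ([] ∷ [])
    λ where (v∈ , here refl) → 1∉tops v∈

  ∈-representatives⁻ : ∀ {r} → r ∈ representatives → r ∈ tops ⊎ r ≡ 1
  ∈-representatives⁻ r∈ with ∈-++⁻ tops r∈
  ... | inj₁ r∈tops     = inj₁ r∈tops
  ... | inj₂ (here r≡1) = inj₂ r≡1

  representatives-inRange : ∀ {r} → r ∈ representatives → InRange n r
  representatives-inRange r∈ with ∈-representatives⁻ r∈
  ... | inj₁ r∈tops = proj₁ (∈-tops⁻ r∈tops)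
  ... | inj₂ refl   = 1-inRange

  representative-≡ : ∀ {a b} → a ∈ representatives → b ∈ representatives → T (a ~ b) → a ≡ b
  representative-≡ a∈ b∈ a~b with ∈-representatives⁻ a∈ | ∈-representatives⁻ b∈
  ... | inj₁ a∈tops | inj₁ b∈tops =
    trans (sym (proj₁ (proj₂ (∈-tops⁻ a∈tops))))
          (trans (sym (cong maxL (class-≡ a~b))) (proj₁ (proj₂ (∈-tops⁻ b∈tops))))
  ... | inj₁ a∈tops | inj₂ refl = ⊥-elim (proj₂ (proj₂ (∈-tops⁻ a∈tops)) a~b)
  ... | inj₂ refl   | inj₁ b∈tops = ⊥-elim (proj₂ (proj₂ (∈-tops⁻ b∈tops)) (symmetric a~b))
  ... | inj₂ refl   | inj₂ refl   = refl

  representative : ∀ {x} → InRange n x → ∃ λ r → r ∈ representatives × T (r ~ x)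
  representative {x} inR with T? (x ~ 1)
  ... | yes x~1 = 1 , ∈-++⁺ʳ tops (here refl) , symmetric x~1
  ... | no  x≁1 = top x , ∈-++⁺ˡ (∈-tops⁺ top-inRange (top-top inR , x≁1 ∘ transitive x~top)) , symmetric x~top
    where
    x~top : T (x ~ top x)
    x~top = ∈-class⁻ (top-∈ inR)
    top-inRange : InRange n (top x)
    top-inRange = proj₂ (support x~top)

  ∈-word⁻ : ∀ {y} → y ∈ word → ∃ λ r → r ∈ representatives × T (r ~ y)
  ∈-word⁻ y∈ with ∈-concat⁻′ (map class representatives) y∈
  ... | _ , y∈b , b∈ with ∈-map⁻ class b∈
  ... | r , r∈ , refl = r , r∈ , ∈-class⁻ y∈b

  ∈-word⁺ : ∀ {r y} → r ∈ representatives → T (r ~ y) → y ∈ word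
  ∈-word⁺ r∈ r~y = ∈-concat⁺′ (∈-class⁺ r~y) (∈-map⁺ class r∈)

  word-IsPermutation : IsPermutation n word
  word-IsPermutation = record
    { unique   = Unique-concat-map class representatives-unique
                   (λ _ → strictlySorted⇒Unique <-trans <-irrefl (class-increasing _))
                   λ a∈ b∈ v∈a v∈b →
                     representative-≡ a∈ b∈ (transitive (∈-class⁻ v∈a) (symmetric (∈-class⁻ v∈b)))
    ; inRange  = λ y∈ → let _ , _ , r~y = ∈-word⁻ y∈ in proj₂ (support r~y)
    ; complete = λ inR → let _ , r∈ , r~x = representative inR in ∈-word⁺ r∈ r~x
    }

  class-1 : ∃ λ t → class 1 ≡ 1 ∷ t
  class-1 = increasing-head (class-increasing 1) (∈-class-self 1-inRange) (proj₁ ∘ proj₂ ∘ support ∘ ∈-class⁻)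

  tops-MaxPrefixRuns : ∀ {ms} → Linked _>_ ms → (∀ {m} → m ∈ ms → m ∈ tops) → MaxPrefixRuns (map class ms)
  tops-MaxPrefixRuns {[]}     _ _    = []
  tops-MaxPrefixRuns {m ∷ ms} s ⊆tops = run-maxL (class-increasing m) (∈-class-self inR)
    (subst (λ t → All (_< t) (concat (map class ms))) (sym top≡) below)
    (tops-MaxPrefixRuns (Linked.tail s) (⊆tops ∘ there))
    where
    inR : InRange n m
    inR = proj₁ (∈-tops⁻ (⊆tops (here refl)))
    top≡ : top m ≡ m
    top≡ = proj₁ (proj₂ (∈-tops⁻ (⊆tops (here refl))))
    below : All (_< m) (concat (map class ms))
    below = All.tabulate λ {y} y∈ → case ∈-concat⁻′ (map class ms) y∈ of λ where
      (_ , y∈b , b∈) → case ∈-map⁻ class b∈ of λ where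
        (m′ , m′∈ , refl) →
          ≤-<-trans (subst (y ≤_) (proj₁ (proj₂ (∈-tops⁻ (⊆tops (there m′∈))))) (≤-top (∈-class⁻ y∈b)))
                                      (All.lookup (Linked-head-All >-trans >-irrefl s) m′∈)

  word-form : ZeroWeightForm word
  word-form = form (map class tops) (proj₁ class-1) word≡ (tops-MaxPrefixRuns tops-decreasing (λ m∈ → m∈))
                   (subst (Linked _<_) (proj₂ class-1) (class-increasing 1))
    where
    word≡ : word ≡ concat (map class tops) ++ 1 ∷ proj₁ class-1
    word≡ = trans (cong concat (Listₚ.map-++ class tops [ 1 ]))
                  (trans (concat-∷ʳ (map class tops) (class 1)) (cong (concat (map class tops) ++_) (proj₂ class-1)))

  runsOf-word : runsOf word ≡ map class representatives
  runsOf-word = trans (runsOf-ZeroWeightForm word-IsPermutation word-form)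
    (sym (trans (Listₚ.map-++ class tops [ 1 ]) (cong (λ r → map class tops ∷ʳ r) (proj₂ class-1))))

  sameRun-word : ∀ x y → sameRun word x y ≡ x ~ y
  sameRun-word x y = T-extensional to from
    where
    to : T (sameRun word x y) → T (x ~ y)
    to sr with find (Anyₚ.map⁻ (subst (Any _) runsOf-word (toWitness {a? = sameRun? word x y} sr)))
    ... | _ , _ , x∈ , y∈ = transitive (symmetric (∈-class⁻ x∈)) (∈-class⁻ y∈)
    from : T (x ~ y) → T (sameRun word x y)
    from x~y with representative (proj₁ (support x~y))
    ... | r , r∈ , r~x = fromWitness {a? = sameRun? word x y} (subst (Any _) (sym runsOf-word)
                           (Anyₚ.map⁺ (lose r∈ (∈-class⁺ r~x , ∈-class⁺ (transitive r~x x~y)))))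

  des-word : des word + 1 ≡ length representatives
  des-word = trans (des-ZeroWeightForm word-IsPermutation word-form)
                   (trans (cong suc (Listₚ.length-map class tops)) (trans (+-comm 1 _) (sym (Listₚ.length-++ tops))))


module RunsOfZeroWeight {n π} (P : IsPermutation n π) (F : ZeroWeightForm π) where
  open ZeroWeightForm F
  open Canonical n (sameRun π)

  runs : List (List ℕ)
  runs = blocks ∷ʳ (1 ∷ tail)

  runs-ascending : AscendingRuns runs
  runs-ascending = proj₁ (ZeroWeightForm-runs P F)

  concat-runs : concat runs ≡ π
  concat-runs = proj₂ (ZeroWeightForm-runs P F)

  runs! : Unique (concat runs)
  runs! = subst Unique (sym concat-runs) (unique P)

  ∈-π⇒run : ∀ {x} → x ∈ π → ∃ λ r → r ∈ runs × x ∈ r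
  ∈-π⇒run x∈ with ∈-concat⁻′ runs (subst (_ ∈_) (sym concat-runs) x∈)
  ... | r , x∈r , r∈ = r , r∈ , x∈r

  run⇒∈-π : ∀ {x r} → r ∈ runs → x ∈ r → x ∈ π
  run⇒∈-π r∈ x∈r = subst (_ ∈_) concat-runs (∈-concat⁺′ x∈r r∈)

  sameRun⁻ : ∀ {x y} → T (sameRun π x y) → ∃ λ r → r ∈ runs × x ∈ r × y ∈ r
  sameRun⁻ {x} {y} sr = find (subst (Any _) (runsOf-ZeroWeightForm P F) (toWitness {a? = sameRun? π x y} sr))

  sameRun⁺ : ∀ {x y r} → r ∈ runs → x ∈ r → y ∈ r → T (sameRun π x y)
  sameRun⁺ {x} {y} r∈ x∈ y∈ =
    fromWitness {a? = sameRun? π x y} (subst (Any _) (sym (runsOf-ZeroWeightForm P F)) (lose r∈ (x∈ , y∈)))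

  sameRun-isEquivalence : IsLetterEquivalence n (sameRun π)
  sameRun-isEquivalence = record
    { support   = λ sr → let r , r∈ , x∈ , y∈ = sameRun⁻ sr in
                    inRange P (run⇒∈-π r∈ x∈) , inRange P (run⇒∈-π r∈ y∈)
    ; reflexive = λ inR → let r , r∈ , x∈ = ∈-π⇒run (complete P inR) in sameRun⁺ r∈ x∈ x∈
    ; transport = λ x~y z → T-extensional (transport-to x~y) (transport-to (swap x~y))
    }
    where
    swap : ∀ {x y} → T (sameRun π x y) → T (sameRun π y x)
    swap sr = let r , r∈ , x∈ , y∈ = sameRun⁻ sr in sameRun⁺ r∈ y∈ x∈
    transport-to : ∀ {x y z} → T (sameRun π x y) → T (sameRun π y z) → T (sameRun π x z)
    transport-to x~y y~z with sameRun⁻ x~y | sameRun⁻ y~z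
    ... | r , r∈ , x∈ , y∈ | r′ , r′∈ , y∈′ , z∈ with Unique-concat-∈ runs! r∈ r′∈ y∈ y∈′
    ... | refl = sameRun⁺ r∈ x∈ z∈

  1∈tail-run : (1 ∷ tail) ∈ runs
  1∈tail-run = ∈-++⁺ʳ blocks (here refl)

  1≤n : 1 ≤ n
  1≤n = proj₂ (inRange P (run⇒∈-π 1∈tail-run (here refl)))

  open CanonicalProperties sameRun-isEquivalence 1≤n

  class-run : ∀ {x r} → r ∈ runs → x ∈ r → class x ≡ r
  class-run {x} {r} r∈ x∈ =
    strictlySorted-≡ <-trans <-irrefl (class-increasing x) (AscendingRuns-increasing runs-ascending r∈) ⊆r ⊇r
    where
    ⊆r : ∀ {y} → y ∈ class x → y ∈ r
    ⊆r y∈ with sameRun⁻ (∈-class⁻ y∈)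
    ... | r′ , r′∈ , x∈′ , y∈′ with Unique-concat-∈ runs! r∈ r′∈ x∈ x∈′
    ... | refl = y∈′
    ⊇r : ∀ {y} → y ∈ r → y ∈ class x
    ⊇r y∈ = ∈-class⁺ (sameRun⁺ r∈ x∈ y∈)

  1∉blocks : ∀ {b} → b ∈ blocks → 1 ∉ b
  1∉blocks b∈ 1∈b =
    Unique-++-disjoint (concat blocks) (subst Unique π≡ (unique P)) (∈-concat⁺′ 1∈b b∈) (here refl) refl

  tops≡ : tops ≡ map maxL blocks
  tops≡ = strictlySorted-≡ >-trans >-irrefl tops-decreasing (MaxPrefixRuns-maxima blocks-max)
                           tops⊆maxima maxima⊆tops
    where
    tops⊆maxima : ∀ {m} → m ∈ tops → m ∈ map maxL blocks
    tops⊆maxima m∈ with ∈-tops⁻ m∈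
    ... | inR , top≡m , m≁1 with ∈-π⇒run (complete P inR)
    ... | r , r∈ , m∈r with ∈-++⁻ blocks r∈
    ... | inj₁ r∈blocks   =
      subst (_∈ map maxL blocks) (trans (cong maxL (sym (class-run r∈ m∈r))) top≡m) (∈-map⁺ maxL r∈blocks)
    ... | inj₂ (here refl) = ⊥-elim (m≁1 (sameRun⁺ r∈ m∈r (here refl)))
    maxima⊆tops : ∀ {m} → m ∈ map maxL blocks → m ∈ tops
    maxima⊆tops m∈ with ∈-map⁻ maxL m∈
    ... | b , b∈ , refl = ∈-tops⁺ (inRange P (run⇒∈-π b∈runs max∈b)) (cong maxL (class-run b∈runs max∈b) , max≁1)
      where
      b∈runs : b ∈ runs
      b∈runs = ∈-++⁺ˡ b∈
      max∈b : maxL b ∈ b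
      max∈b with MaxPrefixRuns-nonempty blocks-max b∈
      ... | x , xs , refl = maxL-∈-∷ x xs
      max≁1 : ¬ T (sameRun π (maxL b) 1)
      max≁1 sr with sameRun⁻ sr
      ... | r′ , r′∈ , max∈′ , 1∈′ with Unique-concat-∈ runs! b∈runs r′∈ max∈b max∈′
      ... | refl = 1∉blocks b∈ 1∈′

  word≡π : word ≡ π
  word≡π = begin
    concat (map class (tops ∷ʳ 1))                  ≡⟨ cong (λ ms → concat (map class (ms ∷ʳ 1))) tops≡ ⟩
    concat (map class (map maxL blocks ∷ʳ 1))       ≡⟨ cong concat (Listₚ.map-++ class (map maxL blocks) [ 1 ]) ⟩
    concat (map class (map maxL blocks) ∷ʳ class 1) ≡⟨ cong₂ (λ bs r → concat (bs ∷ʳ r)) class-blocks class-1-run ⟩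
    concat runs                                     ≡⟨ concat-runs ⟩
    π                                               ∎
    where
    open ≡-Reasoning
    class-1-run : class 1 ≡ 1 ∷ tail
    class-1-run = class-run 1∈tail-run (here refl)
    class-blocks : map class (map maxL blocks) ≡ blocks
    class-blocks = trans (sym (Listₚ.map-∘ blocks)) (Listₚ.map-id-local (All.tabulate λ {b} b∈ →
      case MaxPrefixRuns-nonempty blocks-max b∈ of λ where
        (x , xs , refl) → class-run (∈-++⁺ˡ b∈) (maxL-∈-∷ x xs)))


-- Set partitions as letter equivalences

letter : ∀ {n} → Fin n → ℕ
letter i = suc (toℕ i)

letter-inRange : ∀ {n} (i : Fin n) → InRange n (letter i)
letter-inRange i = s≤s z≤n , toℕ<n i

toFin : ∀ {n x} → InRange n x → Fin n
toFin {x = suc a} (_ , a<n) = fromℕ< a<n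

letter-toFin : ∀ {n x} (inR : InRange n x) → letter (toFin inR) ≡ x
letter-toFin {x = suc a} (_ , a<n) = cong suc (toℕ-fromℕ< a<n)

-- Letters outside 1, …, n have the empty row and belong to no subset.
rowOf : ∀ {n} → Vec (Subset n) n → ℕ → Subset n
rowOf {n} B (suc a) with a <? n
... | yes a<n = lookup B (fromℕ< a<n)
... | no _    = ∅
rowOf B zero = ∅

entry : ∀ {n} → Subset n → ℕ → Bool
entry {n} p (suc a) with a <? n
... | yes a<n = lookup p (fromℕ< a<n)
... | no _    = false
entry p zero = false

related : ∀ {n} → Vec (Subset n) n → ℕ → ℕ → Bool
related B x y = entry (rowOf B x) y

rowOf-letter : ∀ {n} (B : Vec (Subset n) n) i → rowOf B (letter i) ≡ lookup B i
rowOf-letter {n} B i with toℕ i <? n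
... | yes i<n = cong (lookup B) (fromℕ<-toℕ i i<n)
... | no i≮n  = ⊥-elim (i≮n (toℕ<n i))

entry-letter : ∀ {n} (p : Subset n) j → entry p (letter j) ≡ lookup p j
entry-letter {n} p j with toℕ j <? n
... | yes j<n = cong (lookup p) (fromℕ<-toℕ j j<n)
... | no j≮n  = ⊥-elim (j≮n (toℕ<n j))

related-letter : ∀ {n} (B : Vec (Subset n) n) i j → related B (letter i) (letter j) ≡ lookup (lookup B i) j
related-letter B i j rewrite rowOf-letter B i = entry-letter (lookup B i) j

entry-support : ∀ {n} (p : Subset n) {y} → T (entry p y) → InRange n y
entry-support {n} p {suc a} t with a <? n
... | yes a<n = s≤s z≤n , a<n

entry-⊥ : ∀ {n} y → entry (∅ {n}) y ≡ false
entry-⊥ {n} zero    = refl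
entry-⊥ {n} (suc a) with a <? n
... | yes a<n = Vecₚ.lookup-replicate (fromℕ< a<n) false
... | no _    = refl

related-support : ∀ {n} (B : Vec (Subset n) n) {x y} → T (related B x y) → InRange n x × InRange n y
related-support {n} B {zero}  {y} t rewrite entry-⊥ {n} y = ⊥-elim t
related-support {n} B {suc a} {y} t with a <? n
... | yes a<n = (s≤s z≤n , a<n) , entry-support _ t
... | no _    rewrite entry-⊥ {n} y = ⊥-elim t

tabulateRelation : ∀ n → (ℕ → ℕ → Bool) → Vec (Subset n) n
tabulateRelation n R = Vec.tabulate λ i → Vec.tabulate λ j → R (letter i) (letter j)

related-tabulateRelation : ∀ {n} (R : ℕ → ℕ → Bool) → (∀ {x y} → T (R x y) → InRange n x × InRange n y) →
                           ∀ x y → related (tabulateRelation n R) x y ≡ R x y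
related-tabulateRelation {n} R R-support x y =
  T-extensional (λ t → subst T (in-range (related-support _ t)) t) (λ t → subst T (sym (in-range (R-support t))) t)
  where
  in-range : InRange n x × InRange n y → related (tabulateRelation n R) x y ≡ R x y
  in-range (inRx , inRy) =
    subst₂ (λ x y → related (tabulateRelation n R) x y ≡ R x y) (letter-toFin inRx) (letter-toFin inRy)
    (trans (related-letter _ (toFin inRx) (toFin inRy))
           (trans (cong (λ row → lookup row (toFin inRy)) (Vecₚ.lookup∘tabulate _ (toFin inRx)))
                  (Vecₚ.lookup∘tabulate _ (toFin inRy))))

tabulateRelation-related : ∀ {n} (B : Vec (Subset n) n) → tabulateRelation n (related B) ≡ B
tabulateRelation-related B = Vec-≡ λ i → trans (Vecₚ.lookup∘tabulate _ i)
  (Vec-≡ λ j → trans (Vecₚ.lookup∘tabulate _ j) (related-letter B i j))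

module PartitionRelation {n} (B : Vec (Subset n) n) where

  rowOf-≡ : IsLetterEquivalence n (related B) → ∀ {x y} → T (related B x y) → rowOf B y ≡ rowOf B x
  rowOf-≡ E {x} {y} x~y = Vec-≡ λ j →
    trans (sym (entry-letter _ j)) (trans (transport {x} {y} x~y (letter j)) (entry-letter _ j))
    where open IsLetterEquivalence E

  partition⇒isEquivalence : (∀ i → i ∈ₛ lookup B i) → (∀ i j → j ∈ₛ lookup B i → lookup B j ≡ lookup B i) →
                            IsLetterEquivalence n (related B)
  partition⇒isEquivalence selfMem consistent = record
    { support   = related-support B
    ; reflexive = λ inR → subst (λ x → T (related B x x)) (letter-toFin inR)
                    (≡true⇒T (trans (related-letter B (toFin inR) (toFin inR)) (Vecₚ.[]=⇒lookup (selfMem (toFin inR)))))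
    ; transport = λ {x} {y} → transport {x} {y}
    }
    where
    transport : ∀ {x y} → T (related B x y) → ∀ z → related B y z ≡ related B x z
    transport {x} {y} x~y z with related-support B {x} {y} x~y
    ... | inRx , inRy = subst₂ (λ x y → T (related B x y) → related B y z ≡ related B x z)
                               (letter-toFin inRx) (letter-toFin inRy) (transport-letters (toFin inRx) (toFin inRy)) x~y
      where
      transport-letters : ∀ i j → T (related B (letter i) (letter j)) → related B (letter j) z ≡ related B (letter i) z
      transport-letters i j i~j = cong (λ row → entry row z)
        (trans (rowOf-letter B j) (trans (consistent i j j∈i) (sym (rowOf-letter B i))))
        where
        j∈i : j ∈ₛ lookup B i
        j∈i = Vecₚ.lookup⇒[]= j _ (trans (sym (related-letter B i j)) (T⇒≡true i~j))

  module _ (E : IsLetterEquivalence n (related B)) where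
    open IsLetterEquivalence E

    isEquivalence⇒selfMem : ∀ i → i ∈ₛ lookup B i
    isEquivalence⇒selfMem i = Vecₚ.lookup⇒[]= i _
      (trans (sym (related-letter B i i)) (T⇒≡true (reflexive {letter i} (letter-inRange i))))

    isEquivalence⇒consistent : ∀ i j → j ∈ₛ lookup B i → lookup B j ≡ lookup B i
    isEquivalence⇒consistent i j j∈i =
      trans (sym (rowOf-letter B j)) (trans (rowOf-≡ E {letter i} {letter j} i~j) (rowOf-letter B i))
      where
      i~j : T (related B (letter i) (letter j))
      i~j = ≡true⇒T (trans (related-letter B i j) (Vecₚ.[]=⇒lookup j∈i))

    numBlocks≡ : 1 ≤ n → numBlocks B ≡ length (Canonical.representatives n (related B))
    numBlocks≡ 1≤n = trans (↭-length (∼bag⇒↭ (unique∧set⇒bag rows! representativeRows! (mk⇔ to from))))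
                           (Listₚ.length-map (rowOf B) representatives)
      where
      open Canonical n (related B)
      open CanonicalProperties E 1≤n
      _≟ᵛ_ : (u v : Subset n) → Dec (u ≡ v)
      _≟ᵛ_ = Vecₚ.≡-dec _≟ᴮ_
      rows! : Unique (deduplicate _≟ᵛ_ (toList B))
      rows! = deduplicate-! _≟ᵛ_ (toList B)
      representativeRows! : Unique (map (rowOf B) representatives)
      representativeRows! = Unique-map⁺ (rowOf B) representatives-unique λ {a} {b} a∈ b∈ rowa≡rowb →
        representative-≡ a∈ b∈ (subst (λ row → T (entry row b)) (sym rowa≡rowb)
                                      (reflexive {b} (representatives-inRange b∈)))
      to : ∀ {v} → v ∈ deduplicate _≟ᵛ_ (toList B) → v ∈ map (rowOf B) representatives
      to v∈ with ∈-tabulate⁻ (subst (_ ∈_) (toList≡tabulate B) (∈-deduplicate⁻ _≟ᵛ_ (toList B) v∈))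
      ... | i , refl with representative (letter-inRange i)
      ... | r , r∈ , r~i = subst (_∈ map (rowOf B) representatives)
                                 (trans (sym (rowOf-≡ E {r} {letter i} r~i)) (rowOf-letter B i)) (∈-map⁺ (rowOf B) r∈)
      from : ∀ {v} → v ∈ map (rowOf B) representatives → v ∈ deduplicate _≟ᵛ_ (toList B)
      from v∈ with ∈-map⁻ (rowOf B) v∈
      ... | r , r∈ , refl = ∈-deduplicate⁺ _≟ᵛ_ (subst (rowOf B r ∈_) (sym (toList≡tabulate B))
          (subst (_∈ List.tabulate (lookup B)) (trans (sym (rowOf-letter B (toFin inR))) (cong (rowOf B) (letter-toFin inR)))
                 (∈-tabulate⁺ (toFin inR))))
        where
        inR : InRange n r
        inR = representatives-inRange r∈


runPartition : ∀ n → List ℕ → Vec (Subset n) n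
runPartition n π = tabulateRelation n (sameRun π)

module ZeroWeightRuns {n π} (π↭ : π ↭ oneTo n) (w≡0 : w π ≡ 0) (1≤n : 1 ≤ n) where
  P : IsPermutation n π
  P = ↭⇒IsPermutation π↭

  open RunsOfZeroWeight P (w≡0⇒ZeroWeightForm P 1≤n w≡0) using (sameRun-isEquivalence; word≡π)

  related≗sameRun : ∀ x y → related (runPartition n π) x y ≡ sameRun π x y
  related≗sameRun = related-tabulateRelation (sameRun π) (IsLetterEquivalence.support sameRun-isEquivalence)

  runPartition-isEquivalence : IsLetterEquivalence n (related (runPartition n π))
  runPartition-isEquivalence = IsLetterEquivalence-resp (λ x y → sym (related≗sameRun x y)) sameRun-isEquivalence

  runPartition-selfMem : ∀ i → i ∈ₛ lookup (runPartition n π) i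
  runPartition-selfMem = PartitionRelation.isEquivalence⇒selfMem _ runPartition-isEquivalence

  runPartition-consistent : ∀ i j → j ∈ₛ lookup (runPartition n π) i →
                            lookup (runPartition n π) j ≡ lookup (runPartition n π) i
  runPartition-consistent = PartitionRelation.isEquivalence⇒consistent _ runPartition-isEquivalence

  word-runPartition : Canonical.word n (related (runPartition n π)) ≡ π
  word-runPartition = trans (word-cong n related≗sameRun) word≡π

  numBlocks-runPartition : numBlocks (runPartition n π) ≡ des π + 1
  numBlocks-runPartition =
    trans (PartitionRelation.numBlocks≡ _ runPartition-isEquivalence 1≤n)
          (trans (sym (CanonicalProperties.des-word runPartition-isEquivalence 1≤n))
                 (cong (λ σ → des σ + 1) word-runPartition))

module CanonicalPermutation {n} (B : Vec (Subset n) n) (selfMem : ∀ i → i ∈ₛ lookup B i)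
                            (consistent : ∀ i j → j ∈ₛ lookup B i → lookup B j ≡ lookup B i) (1≤n : 1 ≤ n) where
  E : IsLetterEquivalence n (related B)
  E = PartitionRelation.partition⇒isEquivalence B selfMem consistent

  open Canonical n (related B) using (word)
  open CanonicalProperties E 1≤n using (word-IsPermutation; word-form; sameRun-word; des-word)

  word↭ : word ↭ oneTo n
  word↭ = IsPermutation⇒↭ word-IsPermutation

  word-w≡0 : w word ≡ 0
  word-w≡0 = ZeroWeightForm⇒w≡0 word-IsPermutation word-form

  des-word≡numBlocks : des word + 1 ≡ numBlocks B
  des-word≡numBlocks = trans des-word (sym (PartitionRelation.numBlocks≡ B E 1≤n))

  runPartition-word : runPartition n word ≡ B
  runPartition-word =
    trans (Vecₚ.tabulate-cong λ i → Vecₚ.tabulate-cong λ j → sameRun-word _ _) (tabulateRelation-related B)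

module RunPartitionBijection (n k : ℕ) (1≤n : 1 ≤ n) where

  toPartition : ZeroWeightPerm n k → SetPartition n k
  toPartition (mkZWP π π↭ w≡0 des≡) = mkSP (runPartition n π)
    (ZeroWeightRuns.runPartition-selfMem π↭ w≡0 1≤n)
    (ZeroWeightRuns.runPartition-consistent π↭ w≡0 1≤n)
    (trans (ZeroWeightRuns.numBlocks-runPartition π↭ w≡0 1≤n) des≡)

  fromPartition : SetPartition n k → ZeroWeightPerm n k
  fromPartition (mkSP B selfMem consistent blocks≡) = mkZWP (Canonical.word n (related B))
    (CanonicalPermutation.word↭ B selfMem consistent 1≤n)
    (CanonicalPermutation.word-w≡0 B selfMem consistent 1≤n)
    (trans (CanonicalPermutation.des-word≡numBlocks B selfMem consistent 1≤n) blocks≡)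

  mkSP-≡ : ∀ {B B′} .{s c b s′ c′ b′} → B ≡ B′ →
           _≡_ {A = SetPartition n k} (mkSP B s c b) (mkSP B′ s′ c′ b′)
  mkSP-≡ refl = refl

  mkZWP-≡ : ∀ {π π′} .{p w d p′ w′ d′} → π ≡ π′ →
            _≡_ {A = ZeroWeightPerm n k} (mkZWP π p w d) (mkZWP π′ p′ w′ d′)
  mkZWP-≡ refl = refl

  -- The round-trip equations are proved from irrelevant fields, hence recomputed.
  toPartition∘fromPartition : ∀ S → toPartition (fromPartition S) ≡ S
  toPartition∘fromPartition (mkSP B selfMem consistent _) = mkSP-≡ (recompute (Vecₚ.≡-dec (Vecₚ.≡-dec _≟ᴮ_) _ _)
    (CanonicalPermutation.runPartition-word B selfMem consistent 1≤n))

  fromPartition∘toPartition : ∀ Z → fromPartition (toPartition Z) ≡ Z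
  fromPartition∘toPartition (mkZWP π π↭ w≡0 _) = mkZWP-≡ (recompute (Listₚ.≡-dec _≟_ _ _)
    (ZeroWeightRuns.word-runPartition π↭ w≡0 1≤n))

theorem6p3 : (n k : ℕ) → 1 ≤ n → 1 ≤ k → k ≤ n → ZeroWeightPerm n k ⤖ SetPartition n k
theorem6p3 n k 1≤n _ _ = ↔⇒⤖ (mk↔ₛ′ toPartition fromPartition toPartition∘fromPartition fromPartition∘toPartition)
  where open RunPartitionBijection n k 1≤n
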